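{- In any playable coalition model $\mathcal M=(W,E,V)$, for every state $w$ and coalition $C\subseteq N$, each of the regions $R^w_{\mathrm{FC}}(C)$, $R^w_{\mathrm{PD}}(C)$, $R^w_{\mathrm{AD}}(C)$, $R^w_{\mathrm{FI}}(C)$ is order-convex in $(\mathcal P(W),\subseteq)$, i.e. whenever $X,Z$ belong to the region and $X\subseteq Y\subseteq Z$, then $Y$ belongs to the region.
   Context: Let $N=\{1,\dots,n\}$ be a finite set of agents. A coalition model is $\mathcal M=(W,E,V)$ with $W\ne\emptyset$, $E$ assigning to each $w\in W$ and $C\subseteq N$ a family $E_w(C)\subseteq\mathcal P(W)$, and a valuation $V$. For $X\subseteq W$, $\overline X=W\setminus X$. $E_w$ is playable if: (i) $\emptyset\notin E_w(C)$ for all $C$; (ii) $W\in E_w(C)$ for all $C$; (iii) if $X\in E_w(C)$ and $X\subseteq Y\subseteq W$ then $Y\in E_w(C)$; (iv) if $C\cap D=\emptyset$, $X\in E_w(C)$, $Y\in E_w(D)$ then $X\cap Y\in E_w(C\cup D)$; (v) for every $X$, $X\notin E_w(\emptyset)$ iff $\overline X\in E_w(N)$. The model is playable if every $E_w$ is. Define $E_w^*(C)=\{X\subseteq W\mid\overline X\in E_w(C)\}$ and $R^w_{\mathrm{FC}}(C)=E_w(C)\cap E^*_w(C)$, $R^w_{\mathrm{PD}}(C)=E_w(C)\setminus E^*_w(C)$, $R^w_{\mathrm{AD}}(C)=E^*_w(C)\setminus E_w(C)$, $R^w_{\mathrm{FI}}(C)=\mathcal P(W)\setminus(E_w(C)\cup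 E^*_w(C))$. -}

module Defs where

open import Data.Bool using (Bool; true; false; not)
open import Data.Nat using (ℕ)
open import Data.Fin.Subset using (Subset; Empty) renaming (_∩_ to _∩ᶜ_; _∪_ to _∪ᶜ_; ⊥ to ∅ᶜ; ⊤ to Nᶜ)
open import Data.Product using (_×_)
open import Data.Sum using (_⊎_)
open import Relation.Binary.PropositionalEquality using (_≡_)
open import Relation.Nullary using (¬_)

-- Subsets of W are characteristic functions W → Bool (classical power set).
Sub : Set → Set
Sub W = W → Bool

module _ {W : Set} where
  _⊆_ : Sub W → Sub W → Set
  X ⊆ Y = ∀ w → X w ≡ true → Y w ≡ true

  ∁ : Sub W → Sub W
  ∁ X w = not (X w)

  _∩_ : Sub W → Sub W → Sub W
  (X ∩ Y) w = X w Data.Bool.∧ Y w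

  ∅ₛ : Sub W
  ∅ₛ _ = false

  Wₛ : Sub W
  Wₛ _ = true

Family : Set → Set₁
Family W = Sub W → Set

-- Coalition model over agents N = Fin n (coalitions = Subset n);
-- propositional letters indexed by ℕ.
record CoalitionModel (n : ℕ) : Set₁ where
  field
    W  : Set
    w₀ : W                              -- W ≠ ∅
    E  : W → Subset n → Family W
    V  : ℕ → Sub W

record IsPlayable {n : ℕ} {W : Set} (Ew : Subset n → Family W) : Set where
  field
    liveness   : ∀ C → ¬ Ew C ∅ₛ
    safety     : ∀ C → Ew C Wₛ
    outcomeMon : ∀ C X Y → Ew C X → X ⊆ Y → Ew C Y
    superadd   : ∀ C D X Y → Empty (C ∩ᶜ D) → Ew C X → Ew D Y → Ew (C ∪ᶜ D) (X ∩ Y)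
    determ₁    : ∀ X → ¬ Ew ∅ᶜ X → Ew Nᶜ (∁ X)
    determ₂    : ∀ X → Ew Nᶜ (∁ X) → ¬ Ew ∅ᶜ X

Playable : {n : ℕ} → CoalitionModel n → Set
Playable M = ∀ w → IsPlayable (CoalitionModel.E M w)

module _ {n : ℕ} (M : CoalitionModel n) where
  open CoalitionModel M

  E* : W → Subset n → Family W
  E* w C X = E w C (∁ X)

  R-FC R-PD R-AD R-FI : W → Subset n → Family W
  R-FC w C X = E w C X × E* w C X
  R-PD w C X = E w C X × ¬ E* w C X
  R-AD w C X = E* w C X × ¬ E w C X
  R-FI w C X = ¬ (E w C X ⊎ E* w C X)

OrderConvex : {W : Set} → Family W → Set
OrderConvex R = ∀ X Y Z → R X → R Z → X ⊆ Y → Y ⊆ Z → R Y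

-- Only outcome monotonicity of playability matters: E_w(C) is upward closed,
-- so its dual E*_w(C) is downward closed, and each region is an intersection of
-- an upward-closed and a downward-closed family (negation swaps the two kinds).
module Submission where

open import Defs
open import Data.Nat using (ℕ)
open import Data.Fin.Subset using (Subset)
open import Data.Bool using (false; true)
open import Data.Product using (_×_; _,_; uncurry)
open import Data.Sum using (_⊎_; inj₁; inj₂)
open import Function using (_∘_)
open import Relation.Nullary using (¬_)
open import Relation.Nullary.Negation using (_¬-⊎_)
open import Relation.Binary.PropositionalEquality using (refl)

∁-antitone : {W : Set} {X Y : Sub W} → X ⊆ Y → ∁ Y ⊆ ∁ X
∁-antitone {X = X} {Y} X⊆Y w ∁Yw with X w in Xw
... | false = refl
... | true with Y w | X⊆Y w Xw
...   | .true | refl = ∁Yw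

module _ {W : Set} where

  UpwardClosed DownwardClosed : Family W → Set
  UpwardClosed   R = ∀ {X Y} → X ⊆ Y → R X → R Y
  DownwardClosed R = ∀ {X Y} → X ⊆ Y → R Y → R X

  upwardClosed⇒orderConvex : {R : Family W} → UpwardClosed R → OrderConvex R
  upwardClosed⇒orderConvex up X Y Z RX _ X⊆Y _ = up X⊆Y RX

  downwardClosed⇒orderConvex : {R : Family W} → DownwardClosed R → OrderConvex R
  downwardClosed⇒orderConvex down X Y Z _ RZ _ Y⊆Z = down Y⊆Z RZ

  ¬-upwardClosed : {R : Family W} → UpwardClosed R → DownwardClosed (λ X → ¬ R X)
  ¬-upwardClosed up X⊆Y ¬RY RX = ¬RY (up X⊆Y RX)

  ¬-downwardClosed : {R : Family W} → DownwardClosed R → UpwardClosed (λ X → ¬ R X)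
  ¬-downwardClosed down X⊆Y ¬RX RY = ¬RX (down X⊆Y RY)

  dual-downwardClosed : {R : Family W} → UpwardClosed R → DownwardClosed (λ X → R (∁ X))
  dual-downwardClosed up X⊆Y = up (∁-antitone X⊆Y)

  ×-orderConvex : {R S : Family W} → OrderConvex R → OrderConvex S →
                  OrderConvex (λ X → R X × S X)
  ×-orderConvex convR convS X Y Z (RX , SX) (RZ , SZ) X⊆Y Y⊆Z =
    convR X Y Z RX RZ X⊆Y Y⊆Z , convS X Y Z SX SZ X⊆Y Y⊆Z

  ¬⊎-orderConvex : {R S : Family W} → OrderConvex (λ X → ¬ R X × ¬ S X) →
                   OrderConvex (λ X → ¬ (R X ⊎ S X))
  ¬⊎-orderConvex conv X Y Z ¬RSX ¬RSZ X⊆Y Y⊆Z =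
    uncurry _¬-⊎_ (conv X Y Z (split ¬RSX) (split ¬RSZ) X⊆Y Y⊆Z)
    where
    split : ∀ {A B : Set} → ¬ (A ⊎ B) → ¬ A × ¬ B
    split ¬AB = ¬AB ∘ inj₁ , ¬AB ∘ inj₂

module _ {n : ℕ} (M : CoalitionModel n) (playable : Playable M)
         (w : CoalitionModel.W M) (C : Subset n) where
  open CoalitionModel M

  E-upwardClosed : UpwardClosed (E w C)
  E-upwardClosed {X} {Y} X⊆Y EX = IsPlayable.outcomeMon (playable w) C X Y EX X⊆Y

  E*-downwardClosed : DownwardClosed (E* M w C)
  E*-downwardClosed = dual-downwardClosed E-upwardClosed

theorem6p6 : {n : ℕ} (M : CoalitionModel n) → Playable M →
  ∀ (w : CoalitionModel.W M) (C : Subset n) →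
    OrderConvex (R-FC M w C) × OrderConvex (R-PD M w C)
      × OrderConvex (R-AD M w C) × OrderConvex (R-FI M w C)
theorem6p6 M playable w C =
    ×-orderConvex E-convex E*-convex
  , ×-orderConvex E-convex ¬E*-convex
  , ×-orderConvex E*-convex ¬E-convex
  , ¬⊎-orderConvex (×-orderConvex ¬E-convex ¬E*-convex)
  where
  open CoalitionModel M
  E-up : UpwardClosed (E w C)
  E-up = E-upwardClosed M playable w C
  E*-down : DownwardClosed (E* M w C)
  E*-down = E*-downwardClosed M playable w C
  E-convex : OrderConvex (E w C)
  E-convex = upwardClosed⇒orderConvex E-up
  E*-convex : OrderConvex (E* M w C)
  E*-convex = downwardClosed⇒orderConvex E*-down
  ¬E-convex : OrderConvex (λ X → ¬ E w C X)
  ¬E-convex = downwardClosed⇒orderConvex (¬-upwardClosed E-up)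
  ¬E*-convex : OrderConvex (λ X → ¬ E* M w C X)
  ¬E*-convex = upwardClosed⇒orderConvex (¬-downwardClosed E*-down)
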